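{- Let $q$ be a prime power, let $d\ge 2$ be an integer, let $n = 2(d-1)$, and let $f:\mathbb{F}_q^d\to\mathbb{F}_q$ be a linear bipermutive local rule $f(x_1,\ldots,x_d)=a_1x_1+\cdots+a_dx_d$ (with $a_1\neq 0$, $a_d\neq 0$), with associated polynomial $p_f(X) = a_1 + a_2X + \cdots + a_dX^{d-1}\in\mathbb{F}_q[X]$. Let $F:\mathbb{F}_q^{2(d-1)}\to\mathbb{F}_q^{d-1}$ be the no-boundary cellular automaton with local rule $f$. Then $F$ is self-orthogonal if and only if $\gcd(p_f(X), X^n - 1) = 1$.
   Context: For a finite field $\mathbb{F}_q$ and a local rule $f:\mathbb{F}_q^d\to\mathbb{F}_q$, the no-boundary cellular automaton (NBCA) $F:\mathbb{F}_q^{2(d-1)}\to\mathbb{F}_q^{d-1}$ is defined by $F(x_1,\ldots,x_{2(d-1)}) = (f(x_1,\ldots,x_d), f(x_2,\ldots,x_{d+1}),\ldots, f(x_{d-1},\ldots,x_{2(d-1)}))$. The rule $f$ is bipermutive if it is a permutation in the first variable when the others are fixed, and a permutation in the last variable when the others are fixed. Let $N = q^{d-1}$, $[N]=\{1,\ldots,N\}$, fix a bijection $\phi:\mathbb{F}_q^{d-1}\to[N]$ with inverse $\psi$. The Cayley table of $F$ is the $N\times N$ matrix $C_F$ with $C_F(i,j) = \phi(F(\psi(i)\|\psi(j)))$, where $\|$ denotes concatenation; for bipermutive $f$ it is a Latin square. Two Latin squares $L_1,L_2$ of order $N$ are orthogonal if the pairs $(L_1(i,j),L_2(i,j))$, $(i,j)\in[N]\times[N]$,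 are pairwise distinct. $F$ is called self-orthogonal if $C_F$ is orthogonal to its transpose $C_F^\top$. -}

module Defs where

open import Level using (0ℓ)
open import Data.Nat as ℕ using (ℕ; zero; suc; _∸_; _≤_; _<_)
open import Data.Nat.Properties using (+-mono-<-≤)
open import Data.Fin using (Fin; toℕ; fromℕ<; zero; suc)
open import Data.Fin.Properties using (toℕ<n; toℕ≤pred[n])
open import Data.Vec as Vec using (Vec; lookup; tabulate; _++_)
open import Data.List as List using (List; []; _∷_; replicate)
open import Data.Product using (Σ; ∃; _×_; _,_)
open import Function.Bundles using (_↔_; Inverse)
open import Relation.Binary.PropositionalEquality using (_≡_; _≢_)
open import Algebra.Structures using (IsCommutativeRing)

-- Its size is then necessarily a prime power q,
-- and every finite field F_q is (isomorphic to) such a record.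
record FiniteField : Set₁ where
  infixl 6 _+_
  infixl 7 _*_
  field
    Carrier : Set
    _+_ _*_ : Carrier → Carrier → Carrier
    -_      : Carrier → Carrier
    0# 1#   : Carrier
    isCommutativeRing : IsCommutativeRing _≡_ _+_ _*_ -_ 0# 1#
    0≢1     : 0# ≢ 1#
    inverse : ∀ x → x ≢ 0# → Σ Carrier (λ y → x * y ≡ 1#)
    size    : ℕ
    enum    : Carrier ↔ Fin size

module _ (K : FiniteField) where
  open FiniteField K

  sumFin : ∀ {k} → (Fin k → Carrier) → Carrier
  sumFin {zero}  g = 0#
  sumFin {suc k} g = g zero + sumFin (λ i → g (suc i))

  sumℕ : ℕ → (ℕ → Carrier) → Carrier
  sumℕ zero    g = 0#
  sumℕ (suc k) g = sumℕ k g + g k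

  linRule : ∀ {d} → (Fin d → Carrier) → Vec Carrier d → Carrier
  linRule a x = sumFin (λ j → a j * lookup x j)

  -- index of x_{i+j} inside a configuration of length 2m (0-based)
  window : ∀ {m} → Fin m → Fin (suc m) → Fin (m ℕ.+ m)
  window {m} i j = fromℕ< (+-mono-<-≤ (toℕ<n i) (toℕ≤pred[n] j))

  NBCA : ∀ {m} → (Vec Carrier (suc m) → Carrier) → Vec Carrier (m ℕ.+ m) → Vec Carrier m
  NBCA f x = tabulate (λ i → f (tabulate (λ j → lookup x (window i j))))

  CayleyTable : ∀ {m N} → (Vec Carrier (m ℕ.+ m) → Vec Carrier m) →
                (Vec Carrier m ↔ Fin N) → Fin N → Fin N → Fin N
  CayleyTable F φ i j = to (F (from i ++ from j))
    where open Inverse φ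

  SelfOrthogonal : ∀ {m N} → (Vec Carrier (m ℕ.+ m) → Vec Carrier m) →
                   (Vec Carrier m ↔ Fin N) → Set
  SelfOrthogonal F φ = Orthogonal (CayleyTable F φ) (λ i j → CayleyTable F φ j i)
    where
      Orthogonal : ∀ {N} → (Fin N → Fin N → Fin N) → (Fin N → Fin N → Fin N) → Set
      Orthogonal L₁ L₂ = ∀ i j i' j' → L₁ i j ≡ L₁ i' j' → L₂ i j ≡ L₂ i' j' →
                         (i ≡ i') × (j ≡ j')

  -- polynomials over K as coefficient lists (lowest degree first)
  Poly : Set
  Poly = List Carrier

  coeff : Poly → ℕ → Carrier
  coeff []       _       = 0#
  coeff (c ∷ p)  zero    = c
  coeff (c ∷ p)  (suc k) = coeff p k

  mulCoeff : Poly → Poly → ℕ → Carrier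
  mulCoeff p s k = sumℕ (suc k) (λ i → coeff p i * coeff s (k ∸ i))

  _∣ₚ_ : Poly → Poly → Set
  g ∣ₚ r = Σ Poly (λ s → ∀ k → mulCoeff g s k ≡ coeff r k)

  GcdIsOne : Poly → Poly → Set
  GcdIsOne p r = ∀ g → g ∣ₚ p → g ∣ₚ r → g ∣ₚ (1# ∷ [])

  assocPoly : ∀ {d} → (Fin d → Carrier) → Poly
  assocPoly a = List.tabulate a

  -- X^n - 1   (n ≥ 1)
  XnMinus1 : ℕ → Poly
  XnMinus1 n = (- 1#) ∷ (replicate (n ∸ 1) 0# List.++ (1# ∷ []))

{-# OPTIONS --safe #-}
module Submission where

-- Write n = 2m and identify x ‖ y with the n-periodic sequence Z it generates.  Letting X act
-- on sequences as the left shift, F (x ‖ y) ‖ F (y ‖ x) lists the first n values of p_f ◃ Z.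
-- Since the Cayley table is read through a bijection, C_F ⊥ C_Fᵀ says that
-- (x , y) ↦ (F (x ‖ y) , F (y ‖ x)) is injective, i.e. (by linearity) that p_f kills no nonzero
-- n-periodic sequence.  If gcd (p_f , Xⁿ - 1) = 1, the annihilator of such a Z is closed under
-- Euclidean remainders and contains both polynomials, hence a common divisor of them, a unit;
-- so Z = 0.  Conversely, if g t = Xⁿ - 1 with g ∣ p_f, then p_f kills t ◃ Z for every periodic Z,
-- so t kills every n-periodic sequence; testing on a periodic indicator gives deg t ≥ n, whence
-- deg g = 0.

open import Defs hiding (Poly; coeff; mulCoeff; sumℕ; _∣ₚ_)
import Defs
open import Level using (0ℓ)
open import Algebra.Bundles using (CommutativeRing)
import Algebra.Properties.Ring as RingProperties
open import Algebra.Properties.CommutativeSemigroup using (interchange)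
open import Data.Nat as ℕ using (ℕ; zero; suc; _∸_; _≤_; _<_; z≤n; s≤s; _%_; _/_; NonZero)
open import Data.Nat.DivMod using (_mod_; m≡m%n+[m/n]*n; [m+n]%n≡m%n; m<n⇒m%n≡m; m%n<n)
import Data.Nat.Properties as ℕ
open import Data.Fin as Fin using (Fin; zero; suc; toℕ; fromℕ)
open import Data.Fin.Properties using (toℕ-fromℕ<; toℕ-injective; toℕ<n)
open import Data.List as List using ([]; _∷_)
open import Data.Vec using (Vec; []; _∷_; lookup; tabulate; replicate; _++_)
open import Data.Vec.Properties
  using (lookup∘tabulate; tabulate∘lookup; tabulate-cong; lookup-replicate;
         ++-injective; ++-injectiveˡ; ++-injectiveʳ)
open import Data.Product using (∃; ∃₂; _×_; _,_; proj₁; proj₂; map)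
open import Data.Sum using (_⊎_; inj₁; inj₂)
open import Data.Empty using (⊥-elim)
open import Function using (_∘_)
open import Function.Bundles using (Inverse; Injection; _↔_; _⇔_; mk⇔)
open import Function.Properties.Equivalence using () renaming (trans to ⇔-trans)
open import Function.Properties.Inverse using (↔⇒↣; ↔-sym)
open import Relation.Nullary using (yes; no)
open import Relation.Nullary.Decidable using (via-injection)
open import Relation.Binary.Definitions using (DecidableEquality; tri<; tri≈; tri>)
open import Relation.Binary.PropositionalEquality

module _ {A : Set} where
  open import Data.Nat using (_+_; _*_)
  open ≡-Reasoning

  Periodic : ℕ → (ℕ → A) → Set
  Periodic n Z = ∀ k → Z (k + n) ≡ Z k

  record IsPrefix {n} (v : Vec A n) (Z : ℕ → A) : Set where
    constructor isPrefix
    field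
      lookup≡ : ∀ i → lookup v i ≡ Z (toℕ i)

  open IsPrefix public

  periodic-+* : ∀ {n Z} → Periodic n Z → ∀ r q → Z (r + q * n) ≡ Z r
  periodic-+* {n} {Z} per r zero    = cong Z (ℕ.+-identityʳ r)
  periodic-+* {n} {Z} per r (suc q) = begin
    Z (r + (n + q * n))  ≡⟨ cong (λ j → Z (r + j)) (ℕ.+-comm n (q * n)) ⟩
    Z (r + (q * n + n))  ≡⟨ cong Z (sym (ℕ.+-assoc r (q * n) n)) ⟩
    Z (r + q * n + n)    ≡⟨ per (r + q * n) ⟩
    Z (r + q * n)        ≡⟨ periodic-+* per r q ⟩
    Z r                  ∎

  periodic-% : ∀ {n Z} .{{_ : NonZero n}} → Periodic n Z → ∀ k → Z k ≡ Z (k % n)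
  periodic-% {n} {Z} per k =
    trans (cong Z (m≡m%n+[m/n]*n k n)) (periodic-+* per (k % n) (k / n))

  cycle : ∀ {n} .{{_ : NonZero n}} → Vec A n → ℕ → A
  cycle {n} v k = lookup v (k mod n)

  cycle-isPrefix : ∀ {n} .{{_ : NonZero n}} (v : Vec A n) → IsPrefix v (cycle v)
  cycle-isPrefix {n} v = isPrefix λ i →
    cong (lookup v) (toℕ-injective (sym (trans (toℕ-fromℕ< _) (m<n⇒m%n≡m (toℕ<n i)))))

  cycle-periodic : ∀ {n} .{{_ : NonZero n}} (v : Vec A n) → Periodic n (cycle v)
  cycle-periodic {n} v k = cong (lookup v) (toℕ-injective (begin
    toℕ ((k + n) mod n)  ≡⟨ toℕ-fromℕ< _ ⟩
    (k + n) % n          ≡⟨ [m+n]%n≡m%n k n ⟩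
    k % n                ≡⟨ sym (toℕ-fromℕ< _) ⟩
    toℕ (k mod n)        ∎))

  periodic⇒≗cycle : ∀ {n Z} .{{_ : NonZero n}} {v : Vec A n} →
                    Periodic n Z → IsPrefix v Z → Z ≗ cycle v
  periodic⇒≗cycle {n} {Z} {v} per v⊑Z k = begin
    Z k                    ≡⟨ periodic-% per k ⟩
    Z (k % n)              ≡⟨ cong Z (sym (toℕ-fromℕ< (m%n<n k n))) ⟩
    Z (toℕ (k mod n))      ≡⟨ sym (lookup≡ v⊑Z (k mod n)) ⟩
    cycle v k              ∎

  tabulate-isPrefix : ∀ {n} (Z : ℕ → A) → IsPrefix (tabulate {n = n} (Z ∘ toℕ)) Z
  tabulate-isPrefix Z = isPrefix (lookup∘tabulate (Z ∘ toℕ))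

  isPrefix-injective : ∀ {n Z W} {v w : Vec A n} →
                       IsPrefix v Z → IsPrefix w W → Z ≗ W → v ≡ w
  isPrefix-injective {v = v} {w} v⊑Z w⊑W Z≗W = begin
    v                    ≡⟨ sym (tabulate∘lookup v) ⟩
    tabulate (lookup v)  ≡⟨ tabulate-cong lookups≡ ⟩
    tabulate (lookup w)  ≡⟨ tabulate∘lookup w ⟩
    w                    ∎
    where
    lookups≡ : lookup v ≗ lookup w
    lookups≡ i = trans (lookup≡ v⊑Z i) (trans (Z≗W (toℕ i)) (sym (lookup≡ w⊑W i)))

  ++-isPrefix : ∀ {m n Z} (x : Vec A m) {y : Vec A n} →
                IsPrefix x Z → IsPrefix y (Z ∘ (m +_)) → IsPrefix (x ++ y) Z
  ++-isPrefix []      x⊑Z y⊑Z = isPrefix (lookup≡ y⊑Z)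
  ++-isPrefix {Z = Z} (c ∷ x) x⊑Z y⊑Z = isPrefix λ
    { zero    → lookup≡ x⊑Z zero
    ; (suc i) → lookup≡ (++-isPrefix {Z = Z ∘ suc} x (isPrefix (lookup≡ x⊑Z ∘ suc))
                                                     (isPrefix (lookup≡ y⊑Z))) i
    }

  ++-isPrefix⁻ : ∀ {m n Z} (x : Vec A m) {y : Vec A n} →
                 IsPrefix (x ++ y) Z → IsPrefix x Z × IsPrefix y (Z ∘ (m +_))
  ++-isPrefix⁻ []      xy⊑Z = isPrefix (λ ()) , isPrefix (lookup≡ xy⊑Z)
  ++-isPrefix⁻ {Z = Z} (c ∷ x) xy⊑Z
    with ++-isPrefix⁻ {Z = Z ∘ suc} x (isPrefix (lookup≡ xy⊑Z ∘ suc))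
  ... | x⊑Z , y⊑Z = isPrefix (λ { zero → lookup≡ xy⊑Z zero ; (suc i) → lookup≡ x⊑Z i })
                  , isPrefix (lookup≡ y⊑Z)

  swap-isPrefix : ∀ {m Z} (x y : Vec A m) → Periodic (m + m) Z →
                  IsPrefix (x ++ y) Z → IsPrefix (y ++ x) (Z ∘ (m +_))
  swap-isPrefix {m} {Z} x y per xy⊑Z with ++-isPrefix⁻ x xy⊑Z
  ... | x⊑Z , y⊑Z =
    ++-isPrefix y y⊑Z (isPrefix λ i → trans (lookup≡ x⊑Z i) (sym (wrap (toℕ i))))
    where
    wrap : ∀ k → Z (m + (m + k)) ≡ Z k
    wrap k = trans (cong Z (trans (sym (ℕ.+-assoc m m k)) (ℕ.+-comm (m + m) k))) (per k)

  periodic-≗ : ∀ {n Z W} .{{_ : NonZero n}} {v : Vec A n} →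
               Periodic n Z → Periodic n W → IsPrefix v Z → IsPrefix v W → Z ≗ W
  periodic-≗ perZ perW v⊑Z v⊑W k =
    trans (periodic⇒≗cycle perZ v⊑Z k) (sym (periodic⇒≗cycle perW v⊑W k))

module LinearRule (K : FiniteField) where
  open FiniteField K

  ring : CommutativeRing 0ℓ 0ℓ
  ring = record { isCommutativeRing = isCommutativeRing }

  open CommutativeRing ring
    using (_-_; +-assoc; +-comm; *-assoc; *-comm; distribˡ; distribʳ; zeroˡ; zeroʳ;
           +-identityˡ; +-identityʳ; *-identityˡ; *-identityʳ; -‿inverseˡ; -‿inverseʳ;
           +-commutativeSemigroup)
  open RingProperties (CommutativeRing.ring ring)
    using (-1*x≈-x; -‿distribˡ-*; -‿+-comm; x[y-z]≈xy-xz; x∙y⁻¹≈ε⇒x≈y)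
  open ≡-Reasoning

  _≟_ : DecidableEquality Carrier
  _≟_ = via-injection (↔⇒↣ enum) Fin._≟_

  *-≢0 : ∀ {x y} → x ≢ 0# → y ≢ 0# → x * y ≢ 0#
  *-≢0 {x} {y} x≢0 y≢0 xy≡0 with inverse x x≢0
  ... | x⁻¹ , xx⁻¹≡1 = y≢0 (begin
    y                ≡⟨ sym (*-identityˡ y) ⟩
    1# * y           ≡⟨ cong (_* y) (trans (sym xx⁻¹≡1) (*-comm x x⁻¹)) ⟩
    (x⁻¹ * x) * y    ≡⟨ *-assoc x⁻¹ x y ⟩
    x⁻¹ * (x * y)    ≡⟨ cong (x⁻¹ *_) xy≡0 ⟩
    x⁻¹ * 0#         ≡⟨ zeroʳ x⁻¹ ⟩
    0#               ∎)

  +-rearrange : ∀ a b r → b + a ≡ (r + a) + (b - r)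
  +-rearrange a b r = begin
    b + a                 ≡⟨ +-comm b a ⟩
    a + b                 ≡⟨ sym (+-identityʳ _) ⟩
    (a + b) + 0#          ≡⟨ cong ((a + b) +_) (sym (-‿inverseʳ r)) ⟩
    (a + b) + (r - r)     ≡⟨ interchange +-commutativeSemigroup a b r (- r) ⟩
    (a + r) + (b - r)     ≡⟨ cong (_+ (b - r)) (+-comm a r) ⟩
    (r + a) + (b - r)     ∎

  Seq : Set
  Seq = ℕ → Carrier

  0ˢ : Seq
  0ˢ _ = 0#

  sumℕ : ℕ → Seq → Carrier
  sumℕ = Defs.sumℕ K

  sumℕ-cong : ∀ k {g h : Seq} → (∀ i → i < k → g i ≡ h i) → sumℕ k g ≡ sumℕ k h
  sumℕ-cong zero    g≡h = refl
  sumℕ-cong (suc k) g≡h =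
    cong₂ _+_ (sumℕ-cong k (λ i i<k → g≡h i (ℕ.m<n⇒m<1+n i<k))) (g≡h k ℕ.≤-refl)

  sumℕ-zero : ∀ k {g : Seq} → (∀ i → i < k → g i ≡ 0#) → sumℕ k g ≡ 0#
  sumℕ-zero k {g} g≡0 = trans (sumℕ-cong k g≡0) (zeros k)
    where
    zeros : ∀ k → sumℕ k 0ˢ ≡ 0#
    zeros zero    = refl
    zeros (suc k) = trans (+-identityʳ _) (zeros k)

  sumℕ-head : ∀ k (g : Seq) → sumℕ (suc k) g ≡ g 0 + sumℕ k (g ∘ suc)
  sumℕ-head zero    g = trans (+-identityˡ (g 0)) (sym (+-identityʳ (g 0)))
  sumℕ-head (suc k) g = begin
    sumℕ (suc k) g + g (suc k)                ≡⟨ cong (_+ g (suc k)) (sumℕ-head k g) ⟩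
    (g 0 + sumℕ k (g ∘ suc)) + g (suc k)      ≡⟨ +-assoc (g 0) _ _ ⟩
    g 0 + sumℕ (suc k) (g ∘ suc)              ∎

  sumℕ-reverse : ∀ k (g : Seq) → sumℕ (suc k) g ≡ sumℕ (suc k) (λ i → g (k ∸ i))
  sumℕ-reverse zero    g = refl
  sumℕ-reverse (suc k) g = begin
    sumℕ (suc k) g + g (suc k)                    ≡⟨ cong (_+ g (suc k)) (sumℕ-reverse k g) ⟩
    sumℕ (suc k) (λ i → g (k ∸ i)) + g (suc k)    ≡⟨ +-comm _ (g (suc k)) ⟩
    g (suc k) + sumℕ (suc k) (λ i → g (k ∸ i))    ≡⟨ sumℕ-head (suc k) (λ i → g (suc k ∸ i)) ⟨
    sumℕ (suc (suc k)) (λ i → g (suc k ∸ i))      ∎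

  sumℕ-single : ∀ {k j} {g : Seq} → j < k → (∀ i → i < k → i ≢ j → g i ≡ 0#) →
                sumℕ k g ≡ g j
  sumℕ-single {suc k} {j} {g} j<1+k others≡0 with ℕ.m≤n⇒m<n∨m≡n (ℕ.≤-pred j<1+k)
  ... | inj₁ j<k  = begin
    sumℕ k g + g k
      ≡⟨ cong₂ _+_ (sumℕ-single j<k (λ i i<k → others≡0 i (ℕ.m<n⇒m<1+n i<k)))
                   (others≡0 k ℕ.≤-refl (λ k≡j → ℕ.<-irrefl (sym k≡j) j<k)) ⟩
    g j + 0#
      ≡⟨ +-identityʳ (g j) ⟩
    g j
      ∎
  ... | inj₂ refl = begin
    sumℕ k g + g k
      ≡⟨ cong (_+ g k) (sumℕ-zero k (λ i i<k → others≡0 i (ℕ.m<n⇒m<1+n i<k) (ℕ.<⇒≢ i<k))) ⟩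
    0# + g k
      ≡⟨ +-identityˡ (g k) ⟩
    g k
      ∎

  Poly : Set
  Poly = Defs.Poly K

  coeff : Poly → Seq
  coeff = Defs.coeff K

  mulCoeff : Poly → Poly → Seq
  mulCoeff = Defs.mulCoeff K

  infix 4 _∣ₚ_ _≈ₚ_
  _∣ₚ_ : Poly → Poly → Set
  _∣ₚ_ = Defs._∣ₚ_ K

  _≈ₚ_ : Poly → Poly → Set
  p ≈ₚ q = coeff p ≗ coeff q

  infixl 6 _+ₚ_
  infixl 7 _*ₚ_

  _+ₚ_ : Poly → Poly → Poly
  []      +ₚ q       = q
  (c ∷ p) +ₚ []      = c ∷ p
  (c ∷ p) +ₚ (d ∷ q) = (c + d) ∷ (p +ₚ q)

  scale : Carrier → Poly → Poly
  scale c = List.map (c *_)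

  _*ₚ_ : Poly → Poly → Poly
  []      *ₚ q = []
  (c ∷ p) *ₚ q = scale c q +ₚ (0# ∷ p *ₚ q)

  coeff-+ₚ : ∀ p q k → coeff (p +ₚ q) k ≡ coeff p k + coeff q k
  coeff-+ₚ []      q       k       = sym (+-identityˡ _)
  coeff-+ₚ (c ∷ p) []      k       = sym (+-identityʳ _)
  coeff-+ₚ (c ∷ p) (d ∷ q) zero    = refl
  coeff-+ₚ (c ∷ p) (d ∷ q) (suc k) = coeff-+ₚ p q k

  coeff-scale : ∀ c p k → coeff (scale c p) k ≡ c * coeff p k
  coeff-scale c []      k       = sym (zeroʳ c)
  coeff-scale c (x ∷ p) zero    = refl
  coeff-scale c (x ∷ p) (suc k) = coeff-scale c p k

  coeff-*ₚ : ∀ p q k → coeff (p *ₚ q) k ≡ mulCoeff p q k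
  coeff-*ₚ []      q k       = sym (sumℕ-zero (suc k) (λ i _ → zeroˡ _))
  coeff-*ₚ (c ∷ p) q zero    = begin
    coeff (scale c q +ₚ (0# ∷ p *ₚ q)) 0  ≡⟨ coeff-+ₚ (scale c q) _ 0 ⟩
    coeff (scale c q) 0 + 0#              ≡⟨ +-identityʳ _ ⟩
    coeff (scale c q) 0                   ≡⟨ coeff-scale c q 0 ⟩
    c * coeff q 0                         ≡⟨ sym (+-identityˡ _) ⟩
    mulCoeff (c ∷ p) q 0                  ∎
  coeff-*ₚ (c ∷ p) q (suc k) = begin
    coeff (scale c q +ₚ (0# ∷ p *ₚ q)) (suc k)
      ≡⟨ coeff-+ₚ (scale c q) _ (suc k) ⟩
    coeff (scale c q) (suc k) + coeff (p *ₚ q) k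
      ≡⟨ cong₂ _+_ (coeff-scale c q (suc k)) (coeff-*ₚ p q k) ⟩
    c * coeff q (suc k) + mulCoeff p q k
      ≡⟨ sumℕ-head (suc k) (λ i → coeff (c ∷ p) i * coeff q (suc k ∸ i)) ⟨
    mulCoeff (c ∷ p) q (suc k)
      ∎

  mulCoeff-comm : ∀ p q k → mulCoeff p q k ≡ mulCoeff q p k
  mulCoeff-comm p q k = begin
    sumℕ (suc k) (λ i → coeff p i * coeff q (k ∸ i))               ≡⟨ sumℕ-reverse k _ ⟩
    sumℕ (suc k) (λ i → coeff p (k ∸ i) * coeff q (k ∸ (k ∸ i)))   ≡⟨ sumℕ-cong (suc k) swap ⟩
    sumℕ (suc k) (λ i → coeff q i * coeff p (k ∸ i))               ∎
    where
    swap : ∀ i → i < suc k →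
           coeff p (k ∸ i) * coeff q (k ∸ (k ∸ i)) ≡ coeff q i * coeff p (k ∸ i)
    swap i i<1+k = trans (cong (λ j → coeff p (k ∸ i) * coeff q j) (ℕ.m∸[m∸n]≡n (ℕ.≤-pred i<1+k)))
                         (*-comm _ _)

  divisor-cofactor : ∀ g s {A} → (∀ k → mulCoeff g s k ≡ coeff A k) → A ≈ₚ s *ₚ g
  divisor-cofactor g s gs≡A k = sym (trans (coeff-*ₚ s g k) (trans (mulCoeff-comm s g k) (gs≡A k)))

  mulCoeff-zeroˡ : ∀ p q → coeff p ≗ 0ˢ → mulCoeff p q ≗ 0ˢ
  mulCoeff-zeroˡ p q p≡0 k = sumℕ-zero (suc k) (λ i _ → trans (cong (_* _) (p≡0 i)) (zeroˡ _))

  DegreeBelow : ℕ → Poly → Set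
  DegreeBelow b p = ∀ k → b ≤ k → coeff p k ≡ 0#

  record Degree (p : Poly) (d : ℕ) : Set where
    constructor mkDegree
    field
      leading≢0 : coeff p d ≢ 0#
      vanishes  : DegreeBelow (suc d) p

  Degree-∷ : ∀ {p d} c → Degree p d → Degree (c ∷ p) (suc d)
  Degree-∷ c (mkDegree lead≢0 vanishes) =
    mkDegree lead≢0 λ { (suc k) (s≤s d<k) → vanishes k d<k }

  Degree-replicate-++ : ∀ e {p d} → Degree p d → Degree (List.replicate e 0# List.++ p) (e ℕ.+ d)
  Degree-replicate-++ zero    deg = deg
  Degree-replicate-++ (suc e) deg = Degree-∷ 0# (Degree-replicate-++ e deg)

  degree? : ∀ p → coeff p ≗ 0ˢ ⊎ ∃ (Degree p)
  degree? []      = inj₁ (λ _ → refl)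
  degree? (c ∷ p) with degree? p
  ... | inj₂ (d , deg) = inj₂ (suc d , Degree-∷ c deg)
  ... | inj₁ p≡0 with c ≟ 0#
  ...   | yes c≡0 = inj₁ (λ { zero → c≡0 ; (suc k) → p≡0 k })
  ...   | no  c≢0 = inj₂ (0 , mkDegree c≢0 λ { (suc k) _ → p≡0 k })

  degree-< : ∀ {p b d} → DegreeBelow b p → Degree p d → d < b
  degree-< below (mkDegree lead≢0 _) = ℕ.≰⇒> (lead≢0 ∘ below _)

  mulCoeff-leading : ∀ g t {dg dt} → DegreeBelow (suc dg) g → DegreeBelow (suc dt) t →
                     mulCoeff g t (dg ℕ.+ dt) ≡ coeff g dg * coeff t dt
  mulCoeff-leading g t {dg} {dt} g-below t-below =
    trans (sumℕ-single (s≤s (ℕ.m≤m+n dg dt)) others)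
          (cong (λ j → coeff g dg * coeff t j) (ℕ.m+n∸m≡n dg dt))
    where
    others : ∀ i → i < suc (dg ℕ.+ dt) → i ≢ dg → coeff g i * coeff t (dg ℕ.+ dt ∸ i) ≡ 0#
    others i _ i≢dg with ℕ.<-cmp i dg
    ... | tri≈ _ i≡dg _ = ⊥-elim (i≢dg i≡dg)
    ... | tri> _ _ dg<i = trans (cong (_* _) (g-below i dg<i)) (zeroˡ _)
    ... | tri< i<dg _ _ = trans (cong (coeff g i *_) (t-below _ dt<dg+dt∸i)) (zeroʳ _)
      where
      dt<dg+dt∸i : dt < dg ℕ.+ dt ∸ i
      dt<dg+dt∸i = ℕ.m+n≤o⇒m≤o∸n (suc dt)
        (subst (ℕ._≤ dg ℕ.+ dt) (cong suc (ℕ.+-comm i dt)) (ℕ.+-monoˡ-≤ dt i<dg))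

  degree-mulCoeff-< : ∀ g t {dg dt b} → Degree g dg → Degree t dt →
                      (∀ k → b ≤ k → mulCoeff g t k ≡ 0#) → dg ℕ.+ dt < b
  degree-mulCoeff-< g t (mkDegree g-lead g-below) (mkDegree t-lead t-below) gt-below =
    ℕ.≰⇒> λ b≤dg+dt → *-≢0 g-lead t-lead
      (trans (sym (mulCoeff-leading g t g-below t-below)) (gt-below _ b≤dg+dt))

  factors-have-degree : ∀ g t {P d} → (∀ k → mulCoeff g t k ≡ coeff P k) → Degree P d →
                        ∃ (Degree g) × ∃ (Degree t)
  factors-have-degree g t gt≡P (mkDegree P-lead _) with degree? g | degree? t
  ... | inj₁ g≡0   | _          = ⊥-elim (P-lead (trans (sym (gt≡P _)) (mulCoeff-zeroˡ g t g≡0 _)))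
  ... | inj₂ _     | inj₁ t≡0   =
    ⊥-elim (P-lead (trans (sym (gt≡P _)) (trans (mulCoeff-comm g t _) (mulCoeff-zeroˡ t g t≡0 _))))
  ... | inj₂ g-deg | inj₂ t-deg = g-deg , t-deg

  degree-zero⇒∣1 : ∀ {g} → Degree g 0 → g ∣ₚ (1# ∷ [])
  degree-zero⇒∣1 {g} (mkDegree g₀≢0 g-below) with inverse (coeff g 0) g₀≢0
  ... | w , g₀w≡1 = (w ∷ []) , λ { zero    → trans (+-identityˡ _) g₀w≡1
                                 ; (suc k) → sumℕ-zero (suc (suc k)) (vanish k) }
    where
    vanish : ∀ k i → i < suc (suc k) → coeff g i * coeff (w ∷ []) (suc k ∸ i) ≡ 0#
    vanish k zero    _ = zeroʳ _
    vanish k (suc i) _ = trans (cong (_* _) (g-below (suc i) (s≤s z≤n))) (zeroˡ _)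

  record Division (P V : Poly) (dv : ℕ) : Set where
    field
      quotient remainder : Poly
      split              : P ≈ₚ quotient *ₚ V +ₚ remainder
      remainder-degree   : DegreeBelow dv remainder

  module _ {V dv} (V-deg : Degree V dv) where
    open Degree V-deg

    V⁻¹ : Carrier
    V⁻¹ = proj₁ (inverse (coeff V dv) leading≢0)

    VV⁻¹≡1 : coeff V dv * V⁻¹ ≡ 1#
    VV⁻¹≡1 = proj₂ (inverse (coeff V dv) leading≢0)

    top-ratio : Poly → Carrier
    top-ratio S = coeff S dv * V⁻¹

    top-ratio-cancels : ∀ S → top-ratio S * coeff V dv ≡ coeff S dv
    top-ratio-cancels S = begin
      coeff S dv * V⁻¹ * coeff V dv     ≡⟨ *-assoc _ V⁻¹ _ ⟩
      coeff S dv * (V⁻¹ * coeff V dv)   ≡⟨ cong (coeff S dv *_) (trans (*-comm V⁻¹ _) VV⁻¹≡1) ⟩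
      coeff S dv * 1#                   ≡⟨ *-identityʳ _ ⟩
      coeff S dv                        ∎

    reduce : Poly → Poly
    reduce S = S +ₚ scale (- top-ratio S) V

    coeff-reduce : ∀ S k → coeff (reduce S) k ≡ coeff S k - top-ratio S * coeff V k
    coeff-reduce S k = trans (coeff-+ₚ S (scale (- top-ratio S) V) k) (cong (coeff S k +_)
      (trans (coeff-scale (- top-ratio S) V k) (sym (-‿distribˡ-* (top-ratio S) _))))

    reduce-degree : ∀ {S} → DegreeBelow (suc dv) S → DegreeBelow dv (reduce S)
    reduce-degree {S} S-below k dv≤k with ℕ.m≤n⇒m<n∨m≡n dv≤k
    ... | inj₂ refl = begin
      coeff (reduce S) dv                       ≡⟨ coeff-reduce S dv ⟩
      coeff S dv - top-ratio S * coeff V dv     ≡⟨ cong (λ y → coeff S dv - y) (top-ratio-cancels S) ⟩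
      coeff S dv - coeff S dv                   ≡⟨ -‿inverseʳ _ ⟩
      0#                                        ∎
    ... | inj₁ dv<k = begin
      coeff (reduce S) k                        ≡⟨ coeff-reduce S k ⟩
      coeff S k - top-ratio S * coeff V k       ≡⟨ cong₂ (λ a b → a - top-ratio S * b)
                                                          (S-below k dv<k) (vanishes k dv<k) ⟩
      0# - top-ratio S * 0#                     ≡⟨ cong (λ y → 0# - y) (zeroʳ _) ⟩
      0# - 0#                                   ≡⟨ -‿inverseʳ 0# ⟩
      0#                                        ∎

    -- Structural recursion: with P = Q V + R′, the polynomial c + X R′ has degree ≤ dv,
    -- and reducing it once against V gives the remainder of c + X P.
    divide : ∀ P → Division P V dv
    divide [] = record
      { quotient = [] ; remainder = [] ; split = λ _ → refl ; remainder-degree = λ _ _ → refl }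
    divide (c ∷ P) = record
      { quotient         = top-ratio S ∷ Q
      ; remainder        = reduce S
      ; split            = split′
      ; remainder-degree = reduce-degree {S} λ { (suc j) (s≤s dv≤j) → R′-below j dv≤j }
      }
      where
      open Division (divide P)
        renaming (quotient to Q; remainder to R′; split to P≈QV+R′; remainder-degree to R′-below)

      S : Poly
      S = c ∷ R′

      ρV : Seq
      ρV k = top-ratio S * coeff V k

      shifted : ∀ k → coeff (c ∷ P) k ≡ coeff S k + coeff (0# ∷ Q *ₚ V) k
      shifted zero    = sym (+-identityʳ c)
      shifted (suc j) = trans (P≈QV+R′ j) (trans (coeff-+ₚ (Q *ₚ V) R′ j) (+-comm _ _))

      split′ : c ∷ P ≈ₚ (top-ratio S ∷ Q) *ₚ V +ₚ reduce S
      split′ k = begin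
        coeff (c ∷ P) k
          ≡⟨ shifted k ⟩
        coeff S k + coeff (0# ∷ Q *ₚ V) k
          ≡⟨ +-rearrange _ _ (ρV k) ⟩
        (ρV k + coeff (0# ∷ Q *ₚ V) k) + (coeff S k - ρV k)
          ≡⟨ sym (cong₂ _+_ (trans (coeff-+ₚ (scale (top-ratio S) V) _ k)
                                   (cong (_+ _) (coeff-scale (top-ratio S) V k)))
                            (coeff-reduce S k)) ⟩
        coeff ((top-ratio S ∷ Q) *ₚ V) k + coeff (reduce S) k
          ≡⟨ sym (coeff-+ₚ ((top-ratio S ∷ Q) *ₚ V) (reduce S) k) ⟩
        coeff ((top-ratio S ∷ Q) *ₚ V +ₚ reduce S) k
          ∎

  remainder-zero⇒∣ : ∀ {P V dv} (d : Division P V dv) →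
                     coeff (Division.remainder d) ≗ 0ˢ → V ∣ₚ P
  remainder-zero⇒∣ {P} {V} d R≡0 = Q , λ k → begin
    mulCoeff V Q k                ≡⟨ mulCoeff-comm V Q k ⟩
    mulCoeff Q V k                ≡⟨ sym (coeff-*ₚ Q V k) ⟩
    coeff (Q *ₚ V) k              ≡⟨ sym (+-identityʳ _) ⟩
    coeff (Q *ₚ V) k + 0#         ≡⟨ cong (coeff (Q *ₚ V) k +_) (sym (R≡0 k)) ⟩
    coeff (Q *ₚ V) k + coeff R k  ≡⟨ sym (coeff-+ₚ (Q *ₚ V) R k) ⟩
    coeff (Q *ₚ V +ₚ R) k         ≡⟨ sym (split k) ⟩
    coeff P k                     ∎
    where open Division d renaming (quotient to Q; remainder to R)

  RemainderClosed : (Poly → Set) → Set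
  RemainderClosed I = ∀ {P V dv} (d : Division P V dv) → I P → I V → I (Division.remainder d)

  module _ {I : Poly → Set} (I-closed : RemainderClosed I) where

    divides-or-smaller : ∀ {V dv} → Degree V dv → I V → ∀ {P} → I P →
                         V ∣ₚ P ⊎ ∃₂ λ R d → d < dv × Degree R d × I R
    divides-or-smaller V-deg V∈I {P} P∈I with divide V-deg P
    ... | d with degree? (Division.remainder d)
    ...   | inj₁ R≡0         = inj₁ (remainder-zero⇒∣ d R≡0)
    ...   | inj₂ (e , R-deg) =
      inj₂ (_ , e , degree-< (Division.remainder-degree d) R-deg , R-deg , I-closed d P∈I V∈I)

    common-divisor : ∀ {A M dm} → I A → I M → Degree M dm → ∃ λ V → I V × V ∣ₚ A × V ∣ₚ M
    common-divisor {A} {M} {dm} A∈I M∈I M-deg = descend (suc dm) ℕ.≤-refl M-deg M∈I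
      where
      descend : ∀ fuel {V dv} → dv < fuel → Degree V dv → I V → ∃ λ V → I V × V ∣ₚ A × V ∣ₚ M
      descend (suc fuel) {V} dv<1+fuel V-deg V∈I with divides-or-smaller V-deg V∈I A∈I
      ... | inj₂ (R , d , d<dv , R-deg , R∈I) =
        descend fuel (ℕ.<-≤-trans d<dv (ℕ.≤-pred dv<1+fuel)) R-deg R∈I
      ... | inj₁ V∣A with divides-or-smaller V-deg V∈I M∈I
      ...   | inj₂ (R , d , d<dv , R-deg , R∈I) =
        descend fuel (ℕ.<-≤-trans d<dv (ℕ.≤-pred dv<1+fuel)) R-deg R∈I
      ...   | inj₁ V∣M = V , V∈I , V∣A , V∣M

  infixr 5 _◃_

  -- X acts on sequences as the left shift, so (p ◃ Z) i = Σⱼ pⱼ Z (i + j).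
  _◃_ : Poly → Seq → Seq
  ([]      ◃ Z) i = 0#
  ((c ∷ p) ◃ Z) i = c * Z i + (p ◃ Z) (suc i)

  ◃-zeroˡ : ∀ p {Z} → coeff p ≗ 0ˢ → p ◃ Z ≗ 0ˢ
  ◃-zeroˡ []      p≡0 i = refl
  ◃-zeroˡ (c ∷ p) {Z} p≡0 i = trans
    (cong₂ _+_ (trans (cong (_* Z i) (p≡0 0)) (zeroˡ _)) (◃-zeroˡ p (p≡0 ∘ suc) (suc i)))
    (+-identityˡ 0#)

  ◃-zeroʳ : ∀ p {Z} → Z ≗ 0ˢ → p ◃ Z ≗ 0ˢ
  ◃-zeroʳ []      Z≡0 i = refl
  ◃-zeroʳ (c ∷ p) Z≡0 i = trans
    (cong₂ _+_ (trans (cong (c *_) (Z≡0 i)) (zeroʳ c)) (◃-zeroʳ p Z≡0 (suc i)))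
    (+-identityˡ 0#)

  ◃-congˡ : ∀ p q {Z} → p ≈ₚ q → p ◃ Z ≗ q ◃ Z
  ◃-congˡ []      q       p≈q i = sym (◃-zeroˡ q (sym ∘ p≈q) i)
  ◃-congˡ (c ∷ p) []      p≈q i = ◃-zeroˡ (c ∷ p) p≈q i
  ◃-congˡ (c ∷ p) (d ∷ q) {Z} p≈q i =
    cong₂ _+_ (cong (_* Z i) (p≈q 0)) (◃-congˡ p q (p≈q ∘ suc) (suc i))

  ◃-+ₚ : ∀ p q {Z} i → ((p +ₚ q) ◃ Z) i ≡ (p ◃ Z) i + (q ◃ Z) i
  ◃-+ₚ []      q       i = sym (+-identityˡ _)
  ◃-+ₚ (c ∷ p) []      i = sym (+-identityʳ _)
  ◃-+ₚ (c ∷ p) (d ∷ q) {Z} i = begin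
    (c + d) * Z i + ((p +ₚ q) ◃ Z) (suc i)
      ≡⟨ cong₂ _+_ (distribʳ (Z i) c d) (◃-+ₚ p q (suc i)) ⟩
    (c * Z i + d * Z i) + ((p ◃ Z) (suc i) + (q ◃ Z) (suc i))
      ≡⟨ interchange +-commutativeSemigroup _ _ _ _ ⟩
    (c * Z i + (p ◃ Z) (suc i)) + (d * Z i + (q ◃ Z) (suc i))
      ∎

  ◃-scale : ∀ c p {Z} i → (scale c p ◃ Z) i ≡ c * (p ◃ Z) i
  ◃-scale c []      i = sym (zeroʳ c)
  ◃-scale c (x ∷ p) {Z} i = begin
    c * x * Z i + (scale c p ◃ Z) (suc i)  ≡⟨ cong₂ _+_ (*-assoc c x (Z i)) (◃-scale c p (suc i)) ⟩
    c * (x * Z i) + c * (p ◃ Z) (suc i)    ≡⟨ sym (distribˡ c _ _) ⟩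
    c * (x * Z i + (p ◃ Z) (suc i))        ∎

  ◃-*ₚ : ∀ p q {Z} → (p *ₚ q) ◃ Z ≗ p ◃ q ◃ Z
  ◃-*ₚ []      q i = refl
  ◃-*ₚ (c ∷ p) q {Z} i = begin
    ((scale c q +ₚ (0# ∷ p *ₚ q)) ◃ Z) i
      ≡⟨ ◃-+ₚ (scale c q) (0# ∷ p *ₚ q) i ⟩
    (scale c q ◃ Z) i + (0# * Z i + ((p *ₚ q) ◃ Z) (suc i))
      ≡⟨ cong₂ _+_ (◃-scale c q i) (trans (cong₂ _+_ (zeroˡ _) (◃-*ₚ p q (suc i))) (+-identityˡ _)) ⟩
    c * (q ◃ Z) i + (p ◃ q ◃ Z) (suc i)
      ∎

  ◃-translate : ∀ p s {Z} i → (p ◃ (Z ∘ (s ℕ.+_))) i ≡ (p ◃ Z) (s ℕ.+ i)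
  ◃-translate []      s i = refl
  ◃-translate (c ∷ p) s {Z} i =
    cong (c * Z (s ℕ.+ i) +_) (trans (◃-translate p s (suc i)) (cong (p ◃ Z) (ℕ.+-suc s i)))

  ◃-periodic : ∀ p {n Z} → Periodic n Z → Periodic n (p ◃ Z)
  ◃-periodic []      per k = refl
  ◃-periodic (c ∷ p) per k = cong₂ _+_ (cong (c *_) (per k)) (◃-periodic p per (suc k))

  ◃-sub : ∀ p {Z W} i → (p ◃ (λ k → Z k - W k)) i ≡ (p ◃ Z) i - (p ◃ W) i
  ◃-sub []      i = sym (-‿inverseʳ 0#)
  ◃-sub (x ∷ p) {Z} {W} i = begin
    x * (Z i - W i) + (p ◃ (λ k → Z k - W k)) (suc i)
      ≡⟨ cong₂ _+_ (x[y-z]≈xy-xz x (Z i) (W i)) (◃-sub p (suc i)) ⟩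
    (x * Z i - x * W i) + ((p ◃ Z) (suc i) - (p ◃ W) (suc i))
      ≡⟨ interchange +-commutativeSemigroup _ _ _ _ ⟩
    (x * Z i + (p ◃ Z) (suc i)) + (- (x * W i) + - (p ◃ W) (suc i))
      ≡⟨ cong ((x * Z i + (p ◃ Z) (suc i)) +_) (-‿+-comm _ _) ⟩
    (x * Z i + (p ◃ Z) (suc i)) - (x * W i + (p ◃ W) (suc i))
      ∎

  ◃-replicate-++ : ∀ e p {Z} i → ((List.replicate e 0# List.++ p) ◃ Z) i ≡ (p ◃ Z) (e ℕ.+ i)
  ◃-replicate-++ zero    p i = refl
  ◃-replicate-++ (suc e) p {Z} i = begin
    0# * Z i + ((List.replicate e 0# List.++ p) ◃ Z) (suc i)
      ≡⟨ cong₂ _+_ (zeroˡ _) (◃-replicate-++ e p (suc i)) ⟩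
    0# + (p ◃ Z) (e ℕ.+ suc i)
      ≡⟨ +-identityˡ _ ⟩
    (p ◃ Z) (e ℕ.+ suc i)
      ≡⟨ cong (p ◃ Z) (ℕ.+-suc e i) ⟩
    (p ◃ Z) (suc e ℕ.+ i)
      ∎

  ◃-one : ∀ {Z} → (1# ∷ []) ◃ Z ≗ Z
  ◃-one i = trans (+-identityʳ _) (*-identityˡ _)

  ◃-unit : ∀ p {d Z} → (∀ l → l < d → Z l ≡ 0#) → Z d ≡ 1# → DegreeBelow (suc d) p →
           (p ◃ Z) 0 ≡ coeff p d
  ◃-unit []      _ _ _ = refl
  ◃-unit (c ∷ p) {zero} {Z} _ Z₀≡1 p-below = begin
    c * Z 0 + (p ◃ Z) 1  ≡⟨ cong₂ _+_ (trans (cong (c *_) Z₀≡1) (*-identityʳ c))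
                                      (◃-zeroˡ p (λ k → p-below (suc k) (s≤s z≤n)) 1) ⟩
    c + 0#               ≡⟨ +-identityʳ c ⟩
    c                    ∎
  ◃-unit (c ∷ p) {suc d} {Z} Z<d≡0 Zd≡1 p-below = begin
    c * Z 0 + (p ◃ Z) 1     ≡⟨ cong₂ _+_ (trans (cong (c *_) (Z<d≡0 0 (s≤s z≤n))) (zeroʳ c))
                                         (sym (◃-translate p 1 0)) ⟩
    0# + (p ◃ (Z ∘ suc)) 0  ≡⟨ +-identityˡ _ ⟩
    (p ◃ (Z ∘ suc)) 0       ≡⟨ ◃-unit p (λ l l<d → Z<d≡0 (suc l) (s≤s l<d)) Zd≡1
                                        (λ k d<k → p-below (suc k) (s≤s d<k)) ⟩
    coeff p d               ∎

  AnnihilatesPeriodic : ℕ → Poly → Set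
  AnnihilatesPeriodic n p = ∀ Z → Periodic n Z → p ◃ Z ≗ 0ˢ

  TrivialPeriodicKernel : Poly → ℕ → Set
  TrivialPeriodicKernel A n = ∀ Z → Periodic n Z → A ◃ Z ≗ 0ˢ → Z ≗ 0ˢ

  annihilator-closed : ∀ Z → RemainderClosed (λ V → V ◃ Z ≗ 0ˢ)
  annihilator-closed Z {P} {V} d P◃Z≡0 V◃Z≡0 i = begin
    (R ◃ Z) i                       ≡⟨ sym (+-identityˡ _) ⟩
    0# + (R ◃ Z) i                  ≡⟨ cong (_+ (R ◃ Z) i) (sym (◃-zeroʳ Q V◃Z≡0 i)) ⟩
    (Q ◃ V ◃ Z) i + (R ◃ Z) i       ≡⟨ cong (_+ (R ◃ Z) i) (sym (◃-*ₚ Q V i)) ⟩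
    ((Q *ₚ V) ◃ Z) i + (R ◃ Z) i    ≡⟨ sym (◃-+ₚ (Q *ₚ V) R i) ⟩
    ((Q *ₚ V +ₚ R) ◃ Z) i           ≡⟨ sym (◃-congˡ P (Q *ₚ V +ₚ R) split i) ⟩
    (P ◃ Z) i                       ≡⟨ P◃Z≡0 i ⟩
    0#                              ∎
    where open Division d renaming (quotient to Q; remainder to R)

  XnMinus1-degree : ∀ n′ → Degree (XnMinus1 K (suc n′)) (suc n′)
  XnMinus1-degree n′ =
    Degree-∷ (- 1#) (subst (Degree _) (ℕ.+-identityʳ n′) (Degree-replicate-++ n′ one-degree))
    where
    one-degree : Degree (1# ∷ []) 0
    one-degree = mkDegree (0≢1 ∘ sym) λ { (suc k) _ → refl }

  XnMinus1-annihilates : ∀ n′ → AnnihilatesPeriodic (suc n′) (XnMinus1 K (suc n′))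
  XnMinus1-annihilates n′ Z per i = begin
    - 1# * Z i + ((List.replicate n′ 0# List.++ 1# ∷ []) ◃ Z) (suc i)
      ≡⟨ cong (- 1# * Z i +_)
              (trans (◃-replicate-++ n′ (1# ∷ []) (suc i)) (◃-one {Z} (n′ ℕ.+ suc i))) ⟩
    - 1# * Z i + Z (n′ ℕ.+ suc i)
      ≡⟨ cong₂ _+_ (-1*x≈-x (Z i)) (trans (cong Z n′+1+i≡i+n) (per i)) ⟩
    - Z i + Z i
      ≡⟨ -‿inverseˡ (Z i) ⟩
    0#
      ∎
    where
    n′+1+i≡i+n : n′ ℕ.+ suc i ≡ i ℕ.+ suc n′
    n′+1+i≡i+n = trans (ℕ.+-comm n′ (suc i)) (sym (ℕ.+-suc i n′))

  coprime⇒trivialKernel : ∀ A n′ → GcdIsOne K A (XnMinus1 K (suc n′)) →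
                          TrivialPeriodicKernel A (suc n′)
  coprime⇒trivialKernel A n′ coprime Z per A◃Z≡0 k
    with common-divisor (annihilator-closed Z) {A} A◃Z≡0 (XnMinus1-annihilates n′ Z per)
                        (XnMinus1-degree n′)
  ... | V , V◃Z≡0 , V∣A , V∣M with coprime V V∣A V∣M
  ... | u , Vu≡1 = begin
    Z k                 ≡⟨ sym (◃-one {Z} k) ⟩
    ((1# ∷ []) ◃ Z) k   ≡⟨ ◃-congˡ (1# ∷ []) (u *ₚ V) (divisor-cofactor V u {1# ∷ []} Vu≡1) k ⟩
    ((u *ₚ V) ◃ Z) k    ≡⟨ ◃-*ₚ u V k ⟩
    (u ◃ V ◃ Z) k       ≡⟨ ◃-zeroʳ u V◃Z≡0 k ⟩
    0#                  ∎

  cofactor-annihilates : ∀ {A M n} g s t → TrivialPeriodicKernel A n →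
                         (∀ k → mulCoeff g s k ≡ coeff A k) → (∀ k → mulCoeff g t k ≡ coeff M k) →
                         AnnihilatesPeriodic n M → AnnihilatesPeriodic n t
  cofactor-annihilates {A} {M} g s t trivial gs≡A gt≡M M-annihilates Z per =
    trivial (t ◃ Z) (◃-periodic t per) λ i → begin
      (A ◃ t ◃ Z) i          ≡⟨ ◃-congˡ A (s *ₚ g) (divisor-cofactor g s {A} gs≡A) i ⟩
      ((s *ₚ g) ◃ t ◃ Z) i   ≡⟨ ◃-*ₚ s g i ⟩
      (s ◃ g ◃ t ◃ Z) i      ≡⟨ ◃-zeroʳ s g◃t◃Z≡0 i ⟩
      0#                     ∎
    where
    g◃t◃Z≡0 : g ◃ t ◃ Z ≗ 0ˢ
    g◃t◃Z≡0 j = begin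
      (g ◃ t ◃ Z) j     ≡⟨ sym (◃-*ₚ g t j) ⟩
      ((g *ₚ t) ◃ Z) j  ≡⟨ ◃-congˡ (g *ₚ t) M (λ k → trans (coeff-*ₚ g t k) (gt≡M k)) j ⟩
      (M ◃ Z) j         ≡⟨ M-annihilates Z per j ⟩
      0#                ∎

  δ : ℕ → ℕ → Carrier
  δ d k with k ℕ.≟ d
  ... | yes _ = 1#
  ... | no  _ = 0#

  δ-≡ : ∀ d → δ d d ≡ 1#
  δ-≡ d with d ℕ.≟ d
  ... | yes _   = refl
  ... | no  d≢d = ⊥-elim (d≢d refl)

  δ-≢ : ∀ {d k} → k ≢ d → δ d k ≡ 0#
  δ-≢ {d} {k} k≢d with k ℕ.≟ d
  ... | yes k≡d = ⊥-elim (k≢d k≡d)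
  ... | no  _   = refl

  annihilatesPeriodic⇒≤degree : ∀ {n t dt} .{{_ : ℕ.NonZero n}} →
                                AnnihilatesPeriodic n t → Degree t dt → n ≤ dt
  annihilatesPeriodic⇒≤degree {n} {t} {dt} t-annihilates (mkDegree t-lead t-vanishes) =
    ℕ.≮⇒≥ λ dt<n → t-lead (begin
      coeff t dt    ≡⟨ sym (◃-unit t (λ l l<dt → Z<dt≡0 l l<dt dt<n) (Zdt≡1 dt<n) t-vanishes) ⟩
      (t ◃ Z) 0     ≡⟨ t-annihilates Z Z-periodic 0 ⟩
      0#            ∎)
    where
    Z : Seq
    Z k = δ dt (k ℕ.% n)

    Z-periodic : Periodic n Z
    Z-periodic k = cong (δ dt) ([m+n]%n≡m%n k n)

    Zdt≡1 : dt < n → Z dt ≡ 1#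
    Zdt≡1 dt<n = trans (cong (δ dt) (m<n⇒m%n≡m dt<n)) (δ-≡ dt)

    Z<dt≡0 : ∀ l → l < dt → dt < n → Z l ≡ 0#
    Z<dt≡0 l l<dt dt<n = trans (cong (δ dt) (m<n⇒m%n≡m (ℕ.<-trans l<dt dt<n))) (δ-≢ (ℕ.<⇒≢ l<dt))

  trivialKernel⇒coprime : ∀ A n′ → TrivialPeriodicKernel A (suc n′) →
                          GcdIsOne K A (XnMinus1 K (suc n′))
  trivialKernel⇒coprime A n′ trivial g (s , gs≡A) (t , gt≡M)
    with factors-have-degree g t gt≡M (XnMinus1-degree n′)
  ... | (dg , g-deg) , (dt , t-deg) = degree-zero⇒∣1 (subst (Degree g) dg≡0 g-deg)
    where
    n≤dt : suc n′ ≤ dt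
    n≤dt = annihilatesPeriodic⇒≤degree
      (cofactor-annihilates {A} {XnMinus1 K (suc n′)} g s t trivial gs≡A gt≡M (XnMinus1-annihilates n′))
      t-deg

    dg+dt≤n : dg ℕ.+ dt < suc (suc n′)
    dg+dt≤n = degree-mulCoeff-< g t g-deg t-deg
      (λ k n<k → trans (gt≡M k) (Degree.vanishes (XnMinus1-degree n′) k n<k))

    dg≡0 : dg ≡ 0
    dg≡0 = ℕ.n≤0⇒n≡0 (subst (dg ≤_) (ℕ.n∸n≡0 dt)
             (ℕ.m+n≤o⇒m≤o∸n dg (ℕ.≤-trans (ℕ.≤-pred dg+dt≤n) n≤dt)))

  trivialKernel⇔coprime : ∀ A n′ →
                          TrivialPeriodicKernel A (suc n′) ⇔ GcdIsOne K A (XnMinus1 K (suc n′))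
  trivialKernel⇔coprime A n′ = mk⇔ (trivialKernel⇒coprime A n′) (coprime⇒trivialKernel A n′)

  sumFin-cong : ∀ {d} {g h : Fin d → Carrier} → (∀ j → g j ≡ h j) → sumFin K g ≡ sumFin K h
  sumFin-cong {zero}  g≡h = refl
  sumFin-cong {suc d} g≡h = cong₂ _+_ (g≡h Fin.zero) (sumFin-cong (g≡h ∘ Fin.suc))

  ◃-tabulate : ∀ {d} (a : Fin d → Carrier) (Z : Seq) k →
               (List.tabulate a ◃ Z) k ≡ sumFin K (λ j → a j * Z (k ℕ.+ Fin.toℕ j))
  ◃-tabulate {zero}  a Z k = refl
  ◃-tabulate {suc d} a Z k = cong₂ _+_
    (cong (λ l → a Fin.zero * Z l) (sym (ℕ.+-identityʳ k)))
    (trans (◃-tabulate (a ∘ Fin.suc) Z (suc k))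
           (sumFin-cong (λ j → cong (λ l → a (Fin.suc j) * Z l) (sym (ℕ.+-suc k (Fin.toℕ j))))))

  NBCA-isPrefix : ∀ {m} (a : Fin (suc m) → Carrier) {v : Vec Carrier (m ℕ.+ m)} {Z} →
                  IsPrefix v Z → IsPrefix (NBCA K (linRule K a) v) (assocPoly K a ◃ Z)
  NBCA-isPrefix a {v} {Z} v⊑Z = isPrefix λ i → begin
    lookup (NBCA K (linRule K a) v) i
      ≡⟨ lookup∘tabulate _ i ⟩
    sumFin K (λ j → a j * lookup (tabulate (λ j → lookup v (window K i j))) j)
      ≡⟨ sumFin-cong (λ j → cong (a j *_)
           (trans (lookup∘tabulate (lookup v ∘ window K i) j) (window-value j))) ⟩
    sumFin K (λ j → a j * Z (Fin.toℕ i ℕ.+ Fin.toℕ j))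
      ≡⟨ sym (◃-tabulate a Z (Fin.toℕ i)) ⟩
    (assocPoly K a ◃ Z) (Fin.toℕ i)
      ∎
    where
    window-value : ∀ {i} j → lookup v (window K i j) ≡ Z (Fin.toℕ i ℕ.+ Fin.toℕ j)
    window-value {i} j = trans (lookup≡ v⊑Z (window K i j)) (cong Z (toℕ-fromℕ< _))

  NBCA-swap-isPrefix : ∀ {m} (a : Fin (suc m) → Carrier) {Z} (x y : Vec Carrier m) →
                       Periodic (m ℕ.+ m) Z → IsPrefix (x ++ y) Z →
                       IsPrefix (NBCA K (linRule K a) (x ++ y) ++ NBCA K (linRule K a) (y ++ x))
                                (assocPoly K a ◃ Z)
  NBCA-swap-isPrefix {m} a x y per xy⊑Z = ++-isPrefix _ (NBCA-isPrefix a xy⊑Z) (isPrefix λ i →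
    trans (lookup≡ (NBCA-isPrefix a (swap-isPrefix x y per xy⊑Z)) i)
          (◃-translate (assocPoly K a) m (Fin.toℕ i)))

  SwapInjective : ∀ {m} → (Vec Carrier (m ℕ.+ m) → Vec Carrier m) → Set
  SwapInjective {m} F = ∀ (x y x′ y′ : Vec Carrier m) →
    F (x ++ y) ≡ F (x′ ++ y′) → F (y ++ x) ≡ F (y′ ++ x′) → x ≡ x′ × y ≡ y′

  selfOrthogonal⇔swapInjective : ∀ {m N} (F : Vec Carrier (m ℕ.+ m) → Vec Carrier m)
                                 (φ : Vec Carrier m ↔ Fin N) →
                                 SelfOrthogonal K F φ ⇔ SwapInjective F
  selfOrthogonal⇔swapInjective F φ = mk⇔
    (λ so x y x′ y′ e₁ e₂ → map to-injective to-injective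
       (so (to x) (to y) (to x′) (to y′) (entries≡ x y x′ y′ e₁) (entries≡ y x y′ x′ e₂)))
    (λ inj i j i′ j′ e₁ e₂ → map from-injective from-injective
       (inj (from i) (from j) (from i′) (from j′) (to-injective e₁) (to-injective e₂)))
    where
    open Inverse φ using (to; from; strictlyInverseʳ)
    to-injective : ∀ {u v} → to u ≡ to v → u ≡ v
    to-injective = Injection.injective (↔⇒↣ φ)

    from-injective : ∀ {i j} → from i ≡ from j → i ≡ j
    from-injective = Injection.injective (↔⇒↣ (↔-sym φ))

    F-from-to : ∀ u v → F (from (to u) ++ from (to v)) ≡ F (u ++ v)
    F-from-to u v = cong₂ (λ s t → F (s ++ t)) (strictlyInverseʳ u) (strictlyInverseʳ v)

    entries≡ : ∀ u v u′ v′ → F (u ++ v) ≡ F (u′ ++ v′) →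
               CayleyTable K F φ (to u) (to v) ≡ CayleyTable K F φ (to u′) (to v′)
    entries≡ u v u′ v′ e = cong to (trans (F-from-to u v) (trans e (sym (F-from-to u′ v′))))

  module _ {m} .{{_ : ℕ.NonZero (m ℕ.+ m)}} (a : Fin (suc m) → Carrier) where

    private
      F : Vec Carrier (m ℕ.+ m) → Vec Carrier m
      F = NBCA K (linRule K a)

      A : Poly
      A = assocPoly K a

    swapInjective⇒trivialKernel : SwapInjective F → TrivialPeriodicKernel A (m ℕ.+ m)
    swapInjective⇒trivialKernel inj Z per A◃Z≡0 =
      periodic-≗ per (λ _ → refl) (subst (λ u → IsPrefix u Z) xy≡00 xy⊑Z) 00⊑0
      where
      x y 0ᵛ : Vec Carrier m
      x  = tabulate (Z ∘ Fin.toℕ)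
      y  = tabulate (Z ∘ (m ℕ.+_) ∘ Fin.toℕ)
      0ᵛ = replicate m 0#

      xy⊑Z : IsPrefix (x ++ y) Z
      xy⊑Z = ++-isPrefix x (tabulate-isPrefix Z) (tabulate-isPrefix (Z ∘ (m ℕ.+_)))

      00⊑0 : IsPrefix (0ᵛ ++ 0ᵛ) 0ˢ
      00⊑0 = ++-isPrefix 0ᵛ 0⊑0 0⊑0
        where
        0⊑0 : IsPrefix 0ᵛ 0ˢ
        0⊑0 = isPrefix λ i → lookup-replicate i 0#

      images≡ : F (x ++ y) ++ F (y ++ x) ≡ F (0ᵛ ++ 0ᵛ) ++ F (0ᵛ ++ 0ᵛ)
      images≡ = isPrefix-injective (NBCA-swap-isPrefix a x y per xy⊑Z)
        (NBCA-swap-isPrefix a 0ᵛ 0ᵛ (λ _ → refl) 00⊑0)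
        (λ i → trans (A◃Z≡0 i) (sym (◃-zeroʳ A (λ _ → refl) i)))

      xy≡00 : x ++ y ≡ 0ᵛ ++ 0ᵛ
      xy≡00 with inj x y 0ᵛ 0ᵛ (++-injectiveˡ _ _ images≡) (++-injectiveʳ _ _ images≡)
      ... | x≡0 , y≡0 = cong₂ _++_ x≡0 y≡0

    trivialKernel⇒swapInjective : TrivialPeriodicKernel A (m ℕ.+ m) → SwapInjective F
    trivialKernel⇒swapInjective trivial x y x′ y′ e₁ e₂ =
      ++-injective x x′
        (isPrefix-injective (cycle-isPrefix (x ++ y)) (cycle-isPrefix (x′ ++ y′)) Z≗Z′)
      where
      Z Z′ D : Seq
      Z    = cycle (x ++ y)
      Z′   = cycle (x′ ++ y′)
      D k  = Z k - Z′ k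

      Z-periodic : Periodic (m ℕ.+ m) Z
      Z-periodic = cycle-periodic (x ++ y)

      Z′-periodic : Periodic (m ℕ.+ m) Z′
      Z′-periodic = cycle-periodic (x′ ++ y′)

      images-agree : A ◃ Z ≗ A ◃ Z′
      images-agree = periodic-≗ (◃-periodic A Z-periodic) (◃-periodic A Z′-periodic)
        (NBCA-swap-isPrefix a x y Z-periodic (cycle-isPrefix (x ++ y)))
        (subst (λ u → IsPrefix u (A ◃ Z′)) (sym (cong₂ _++_ e₁ e₂))
               (NBCA-swap-isPrefix a x′ y′ Z′-periodic (cycle-isPrefix (x′ ++ y′))))

      D≗0 : D ≗ 0ˢ
      D≗0 = trivial D (λ k → cong₂ _-_ (Z-periodic k) (Z′-periodic k)) λ i →
        trans (◃-sub A i) (trans (cong (_- (A ◃ Z′) i) (images-agree i)) (-‿inverseʳ _))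

      Z≗Z′ : Z ≗ Z′
      Z≗Z′ k = x∙y⁻¹≈ε⇒x≈y _ _ (D≗0 k)

    swapInjective⇔trivialKernel : SwapInjective F ⇔ TrivialPeriodicKernel A (m ℕ.+ m)
    swapInjective⇔trivialKernel = mk⇔ swapInjective⇒trivialKernel trivialKernel⇒swapInjective


open import Data.Nat using (_+_)

theorem3 : (K : FiniteField) → (m : ℕ) → 1 ≤ m →
    (a : Fin (suc m) → FiniteField.Carrier K) →
    a zero ≢ FiniteField.0# K → a (fromℕ m) ≢ FiniteField.0# K →
    (N : ℕ) → (φ : Vec (FiniteField.Carrier K) m ↔ Fin N) →
    SelfOrthogonal K (NBCA K (linRule K a)) φ ⇔ GcdIsOne K (assocPoly K a) (XnMinus1 K (m + m))
theorem3 K (suc m) _ a _ _ N φ =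
  ⇔-trans (selfOrthogonal⇔swapInjective (NBCA K (linRule K a)) φ)
    (⇔-trans (swapInjective⇔trivialKernel a)
      (trivialKernel⇔coprime (assocPoly K a) (m + suc m)))
  where open LinearRule K
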